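{- For every integer $s \ge 2$, the oriented graph $D_s$ is not tileable.
   Context: An oriented graph is a loopless directed graph with at most one of $uv$, $vu$ for each pair of distinct vertices; a tournament has exactly one. $\delta^0(G)$ denotes the minimum semi-degree, i.e. the minimum of all in- and out-degrees of vertices of $G$. An oriented graph $G$ on $n$ vertices with $\delta^0(G) = \lfloor (n-1)/2 \rfloor$ is called a semi-regular tournament. For an oriented graph $H$, an $H$-tiling in $G$ is a collection of vertex-disjoint copies of $H$ in $G$; it is perfect if it covers all vertices of $G$. An oriented graph $H$ on $h$ vertices is tileable if there exists $n_0$ such that every semi-regular tournament on $n \ge n_0$ vertices with $h \mid n$ contains a perfect $H$-tiling. For $s \ge 1$, $D_s$ is the tournament on $3s$ vertices whose vertex set is partitioned into three sets $A,B,C$ of size $s$, each inducing a transitive tournament, with all edges between distinct parts oriented from $A$ to $B$, from $B$ to $C$, and from $C$ to $A$. -}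

module Defs where

open import Data.Nat using (ℕ; zero; suc; _+_; _*_; _∸_; _≤_; _≡ᵇ_; _<ᵇ_; NonZero)
open import Data.Nat.DivMod using (_/_; _%_)
open import Data.Nat.Divisibility using (_∣_)
open import Data.Fin using (Fin; toℕ)
open import Data.Bool using (Bool; true; false; if_then_else_)
open import Data.List using (List; allFin; map)
open import Data.Nat.ListAction using (sum)
open import Data.Product using (_×_; ∃; ∃-syntax; Σ-syntax)
open import Data.Sum using (_⊎_)
open import Relation.Binary.PropositionalEquality using (_≡_)

Digraph : ℕ → Set
Digraph n = Fin n → Fin n → Bool

IsOriented : ∀ {n} → Digraph n → Set
IsOriented {n} G =
  ((v : Fin n) → G v v ≡ false) ×
  ((u v : Fin n) → G u v ≡ true → G v u ≡ false)

indicator : Bool → ℕ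
indicator true  = 1
indicator false = 0

outdeg : ∀ {n} → Digraph n → Fin n → ℕ
outdeg {n} G v = sum (map (λ w → indicator (G v w)) (allFin n))

indeg : ∀ {n} → Digraph n → Fin n → ℕ
indeg {n} G v = sum (map (λ w → indicator (G w v)) (allFin n))

MinSemiDegree : ∀ {n} → Digraph n → ℕ → Set
MinSemiDegree {n} G k =
  ((v : Fin n) → (k ≤ outdeg G v) × (k ≤ indeg G v)) ×
  (∃[ v ] (outdeg G v ≡ k ⊎ indeg G v ≡ k))

IsSemiRegularTournament : ∀ {n} → Digraph n → Set
IsSemiRegularTournament {n} G = IsOriented G × MinSemiDegree G ((n ∸ 1) / 2)

-- A perfect H-tiling of G: a family of m copies φ k (k : Fin m) which are
-- vertex-disjoint (the combined map (k , i) ↦ φ k i is injective) and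
-- cover every vertex of G.
PerfectTiling : ∀ {h n} → Digraph h → Digraph n → Set
PerfectTiling {h} {n} H G =
  ∃[ m ] Σ[ φ ∈ (Fin m → Fin h → Fin n) ]
    ( ((k : Fin m) (i j : Fin h) → H i j ≡ true → G (φ k i) (φ k j) ≡ true)
    × ((k k′ : Fin m) (i i′ : Fin h) → φ k i ≡ φ k′ i′ → (k ≡ k′) × (i ≡ i′))
    × ((v : Fin n) → ∃[ k ] ∃[ i ] (φ k i ≡ v)) )

Tileable : ∀ {h} → Digraph h → Set
Tileable {h} H =
  ∃[ n₀ ] ((n : ℕ) → n₀ ≤ n → h ∣ n →
     (G : Digraph n) → IsSemiRegularTournament G → PerfectTiling H G)

-- D_s on vertex set Fin (3 s): vertex i lies in part ⌊i / s⌋ ∈ {0,1,2}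
-- (A = 0, B = 1, C = 2) of size s; inside a part, i → j iff i < j
-- (transitive tournament); between parts, edges go A → B → C → A.
part : (s : ℕ) .{{_ : NonZero s}} → Fin (3 * s) → ℕ
part s i = toℕ i / s

D : (s : ℕ) .{{_ : NonZero s}} → Digraph (3 * s)
D s i j =
  if part s i ≡ᵇ part s j
  then toℕ i <ᵇ toℕ j
  else (part s j ≡ᵇ ((part s i + 1) % 3))

{-# OPTIONS --safe #-}
-- Let G_q have vertex classes V₀, V₁, V₂ of sizes 2q + 1, 2q + 2, 2q + 3 carrying circulants
-- with arc lengths 1, …, q, 1, …, q and 1, …, q + 1, all arcs V₀ → V₁ and V₂ → V₀, and all
-- arcs V₁ → V₂ except along a matching of V₁ into V₂, which is reversed.  Every vertex
-- then has in- and out-degree at least 3q + 2 = ⌊(|G_q| − 1)/2⌋, attained on V₀.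
-- There are no arcs V₀ → V₂ or V₁ → V₀, so a cyclic triangle through a vertex of V₀ stays in V₀
-- or passes through V₀, V₁, V₂ in this order; and the reversed matching gives each vertex of V₂
-- a unique out-neighbour in V₁ and each vertex of V₁ a unique in-neighbour in V₂.  As the parts
-- of D_s are joined cyclically by cyclic triangles, for s ≥ 2 each part of a copy of D_s lies
-- inside V₀ or avoids it.  So a perfect D_s-tiling of G_q forces s ∣ |V₀| = 2q + 1, which fails
-- when s ∣ q + 1.

module Submission where

open import Defs
open import Data.Nat using (ℕ; _≤_; NonZero)
open import Relation.Nullary using (¬_)

open import Data.Bool using (Bool; true; false; T; not; if_then_else_)
open import Data.Bool.Properties using (¬-not; not-involutive)
open import Data.Empty using (⊥)
open import Data.Fin using (Fin; toℕ; zero; suc; _↑ˡ_; _↑ʳ_; splitAt; join; combine; remQuot; opposite)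
open import Data.Fin.Patterns using (0F; 1F; 2F)
open import Data.Fin.Permutation using (Permutation; permutation)
open import Data.Fin.Properties
  using (toℕ<n; toℕ-injective; opposite-prop; opposite-involutive; splitAt-↑ˡ; splitAt-↑ʳ; join-splitAt;
         remQuot-combine; combine-remQuot; toℕ-combine; combine-injective; any?)
open import Data.List using (map; allFin; tabulate)
open import Data.List.Properties using (map-tabulate)
open import Data.Nat
open import Data.Nat.DivMod
  using ([m+n]%n≡m%n; m<n⇒m%n≡m; n%n≡0; m*n/n≡m; m<n⇒m/n≡0; +-distrib-/-∣ˡ; +-distrib-/-∣ʳ)
open import Data.Nat.Divisibility
  using (_∣_; divides; _∣0; ∣-refl; ∣-trans; ∣m∣n⇒∣m+n; ∣m+n∣m⇒∣n; ∣1⇒≡1; m∣m*n; n∣m*n; *-monoʳ-∣)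
open import Data.Nat.ListAction using (sum)
open import Data.Nat.Properties
open import Data.Nat.Tactic.RingSolver using (solve-∀)
open import Data.Product using (_,_; _×_; ∃; proj₁; proj₂; uncurry)
open import Data.Sum using (_⊎_; inj₁; inj₂; map₂; [_,_]′)
open import Function using (_∘_; id)
open import Relation.Binary.PropositionalEquality
open import Relation.Nullary using (Dec; yes; no; contradiction)

open import Algebra.Properties.CommutativeMonoid.Sum +-0-commutativeMonoid
  using (sum-syntax; sum-cong-≗; sum-permute; sum-replicate-zero)
open ≡-Reasoning

∑< : ℕ → (ℕ → ℕ) → ℕ
∑< n f = ∑[ j < n ] f (toℕ j)

sum-allFin : ∀ n (f : Fin n → ℕ) → sum (map f (allFin n)) ≡ ∑[ i < n ] f i
sum-allFin n f = trans (cong sum (map-tabulate id f)) (sum-tabulate n f)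
  where
  sum-tabulate : ∀ n (f : Fin n → ℕ) → sum (tabulate f) ≡ ∑[ i < n ] f i
  sum-tabulate zero    f = refl
  sum-tabulate (suc n) f = cong (f zero +_) (sum-tabulate n (f ∘ suc))

∑-zero : ∀ n → ∑[ i < n ] 0 ≡ 0
∑-zero = sum-replicate-zero

∑-one : ∀ n → ∑[ i < n ] 1 ≡ n
∑-one zero    = refl
∑-one (suc n) = cong suc (∑-one n)

∑-∣ : ∀ {d n} (f : Fin n → ℕ) → (∀ i → d ∣ f i) → d ∣ ∑[ i < n ] f i
∑-∣ {d} {zero}  f d∣f = d ∣0
∑-∣ {d} {suc n} f d∣f = ∣m∣n⇒∣m+n (d∣f zero) (∑-∣ (f ∘ suc) (d∣f ∘ suc))

∑-++ : ∀ m {n} (f : Fin (m + n) → ℕ) →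
       ∑[ i < m + n ] f i ≡ ∑[ i < m ] f (i ↑ˡ n) + ∑[ j < n ] f (m ↑ʳ j)
∑-++ zero    f = refl
∑-++ (suc m) f = trans (cong (f zero +_) (∑-++ m (f ∘ suc))) (sym (+-assoc (f zero) _ _))

∑-combine : ∀ m n (f : Fin (m * n) → ℕ) →
            ∑[ x < m * n ] f x ≡ ∑[ i < m ] ∑[ j < n ] f (combine i j)
∑-combine zero    n f = refl
∑-combine (suc m) n f =
  trans (∑-++ n f) (cong (∑[ j < n ] f (j ↑ˡ m * n) +_) (∑-combine m n (f ∘ (n ↑ʳ_))))

∑<-cong : ∀ n {f g} → (∀ j → j < n → f j ≡ g j) → ∑< n f ≡ ∑< n g
∑<-cong n f≡g = sum-cong-≗ (λ j → f≡g (toℕ j) (toℕ<n j))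

∑<-snoc : ∀ n f → ∑< (suc n) f ≡ ∑< n f + f n
∑<-snoc zero    f = +-comm (f 0) 0
∑<-snoc (suc n) f = begin
  f 0 + ∑< (suc n) (f ∘ suc)     ≡⟨ cong (f 0 +_) (∑<-snoc n (f ∘ suc)) ⟩
  f 0 + (∑< n (f ∘ suc) + f (suc n)) ≡⟨ +-assoc (f 0) _ _ ⟨
  ∑< (suc n) f + f (suc n)       ∎

∑<-rotate : ∀ n f → f n ≡ f 0 → ∑< n (f ∘ suc) ≡ ∑< n f
∑<-rotate n f fn≡f0 = +-cancelˡ-≡ (f 0) _ _ (begin
  ∑< (suc n) f  ≡⟨ ∑<-snoc n f ⟩
  ∑< n f + f n  ≡⟨ cong (∑< n f +_) fn≡f0 ⟩
  ∑< n f + f 0  ≡⟨ +-comm _ (f 0) ⟩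
  f 0 + ∑< n f  ∎)

∑<-periodic : ∀ m c f → (∀ j → f (j + m) ≡ f j) → ∑< m (λ j → f (c + j)) ≡ ∑< m f
∑<-periodic m zero    f periodic = refl
∑<-periodic m (suc c) f periodic =
  trans (∑<-periodic m c (f ∘ suc) (periodic ∘ suc)) (∑<-rotate m f (periodic 0))

∑<-reverse : ∀ n f → ∑< n f ≡ ∑< n (λ j → f (n ∸ suc j))
∑<-reverse n f = trans (sum-permute (f ∘ toℕ) reversal)
                       (sum-cong-≗ (λ j → cong f (opposite-prop {n} j)))
  where
  reversal : Permutation n n
  reversal = permutation opposite opposite opposite-involutive opposite-involutive

∑<-<ᵇ : ∀ {r n} → r ≤ n → ∑< n (λ j → indicator (j <ᵇ r)) ≡ r
∑<-<ᵇ {zero}  {n}     _         = ∑-zero n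
∑<-<ᵇ {suc r} {suc n} (s≤s r≤n) = cong suc (∑<-<ᵇ r≤n)

∑<-≡ᵇ : ∀ {x n} → x < n → ∑< n (λ j → indicator (j ≡ᵇ x)) ≡ 1
∑<-≡ᵇ {zero}  {suc n} _         = cong suc (∑-zero n)
∑<-≡ᵇ {suc x} {suc n} (s≤s x<n) = ∑<-≡ᵇ x<n

∑<-≢ᵇ : ∀ {x n} → x < suc n → ∑< (suc n) (λ j → indicator (not (j ≡ᵇ x))) ≡ n
∑<-≢ᵇ {zero}  {n}     _          = ∑-one n
∑<-≢ᵇ {suc x} {suc n} (s≤s x<sn) = cong suc (∑<-≢ᵇ x<sn)

∑<-≢ᵇ-≥ : ∀ x n → n ≤ ∑< (suc n) (λ j → indicator (not (x ≡ᵇ j)))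
∑<-≢ᵇ-≥ zero    n       = ≤-reflexive (sym (∑-one n))
∑<-≢ᵇ-≥ (suc x) zero    = z≤n
∑<-≢ᵇ-≥ (suc x) (suc n) = s≤s (∑<-≢ᵇ-≥ x n)

<ᵇ-true⇒< : ∀ {m n} → (m <ᵇ n) ≡ true → m < n
<ᵇ-true⇒< {m} {n} eq = <ᵇ⇒< m n (subst T (sym eq) _)

≡ᵇ-true⇒≡ : ∀ m n → (m ≡ᵇ n) ≡ true → m ≡ n
≡ᵇ-true⇒≡ m n eq = ≡ᵇ⇒≡ m n (subst T (sym eq) _)

infix 4 1≤_≤ᵇ_

1≤_≤ᵇ_ : ℕ → ℕ → Bool
1≤ zero  ≤ᵇ r = false
1≤ suc e ≤ᵇ r = e <ᵇ r

1≤≤ᵇ⇒≤ : ∀ e r → (1≤ e ≤ᵇ r) ≡ true → e ≤ r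
1≤≤ᵇ⇒≤ (suc e) r e<r = <ᵇ-true⇒< e<r

-- Adding m avoids truncated subtraction: for a, b < m this tests b − a modulo m.
circulant : (m r : ℕ) .{{_ : NonZero m}} → ℕ → ℕ → Bool
circulant m r a b = 1≤ (b + m ∸ a) % m ≤ᵇ r

∑<-1≤≤ᵇ : ∀ {m r} .{{_ : NonZero m}} → r < m → ∑< m (λ e → indicator (1≤ e % m ≤ᵇ r)) ≡ r
∑<-1≤≤ᵇ {suc m} {r} (s≤s r≤m) = trans
  (∑<-cong (suc m) (λ e e<m → cong (λ e → indicator (1≤ e ≤ᵇ r)) (m<n⇒m%n≡m e<m)))
  (∑<-<ᵇ r≤m)

-- Both semi-degrees sum an m-periodic indicator over m consecutive values (for the in-degree
-- after reversing the order of summation).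
module _ {m : ℕ} .{{_ : NonZero m}} {r : ℕ} where

  private
    step : ℕ → ℕ
    step e = indicator (1≤ e % m ≤ᵇ r)

    step-periodic : ∀ e → step (e + m) ≡ step e
    step-periodic e = cong (λ e → indicator (1≤ e ≤ᵇ r)) ([m+n]%n≡m%n e m)

  circulant-outdegree : ∀ {a} → a < m → r < m → ∑< m (λ b → indicator (circulant m r a b)) ≡ r
  circulant-outdegree {a} a<m r<m = begin
    ∑< m (λ b → step (b + m ∸ a))  ≡⟨ ∑<-cong m (λ b _ → cong step (shift b)) ⟩
    ∑< m (λ b → step (m ∸ a + b))  ≡⟨ ∑<-periodic m (m ∸ a) step step-periodic ⟩
    ∑< m step                      ≡⟨ ∑<-1≤≤ᵇ r<m ⟩
    r                              ∎
    where
    shift : ∀ b → b + m ∸ a ≡ m ∸ a + b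
    shift b = trans (+-∸-assoc b (<⇒≤ a<m)) (+-comm b (m ∸ a))

  circulant-indegree : ∀ {a} → a < m → r < m → ∑< m (λ b → indicator (circulant m r b a)) ≡ r
  circulant-indegree {a} a<m r<m = begin
    ∑< m (λ b → step (a + m ∸ b))               ≡⟨ ∑<-reverse m (λ b → step (a + m ∸ b)) ⟩
    ∑< m (λ b → step (a + m ∸ (m ∸ suc b)))     ≡⟨ ∑<-cong m (λ b b<m → cong step (reflect b<m)) ⟩
    ∑< m (λ b → step (suc a + b))               ≡⟨ ∑<-periodic m (suc a) step step-periodic ⟩
    ∑< m step                                   ≡⟨ ∑<-1≤≤ᵇ r<m ⟩
    r                                           ∎
    where
    reflect : ∀ {b} → b < m → a + m ∸ (m ∸ suc b) ≡ suc a + b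
    reflect {b} b<m = begin
      a + m ∸ (m ∸ suc b)    ≡⟨ +-∸-assoc a (m∸n≤m m (suc b)) ⟩
      a + (m ∸ (m ∸ suc b))  ≡⟨ cong (a +_) (m∸[m∸n]≡n b<m) ⟩
      a + suc b              ≡⟨ +-suc a b ⟩
      suc a + b              ∎

  circulant-irrefl : ∀ a → circulant m r a a ≡ false
  circulant-irrefl a = cong (1≤_≤ᵇ r) (trans (cong (_% m) (m+n∸m≡n a m)) (n%n≡0 m))

  circulant-forward : ∀ a k → k < m → circulant m r a (a + k) ≡ (1≤ k ≤ᵇ r)
  circulant-forward a k k<m = cong (1≤_≤ᵇ r) (begin
    (a + k + m ∸ a) % m  ≡⟨ cong (λ x → (x ∸ a) % m) (+-assoc a k m) ⟩
    (a + (k + m) ∸ a) % m ≡⟨ cong (_% m) (m+n∸m≡n a (k + m)) ⟩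
    (k + m) % m          ≡⟨ [m+n]%n≡m%n k m ⟩
    k % m                ≡⟨ m<n⇒m%n≡m k<m ⟩
    k                    ∎)

  circulant-backward : ∀ a k → 0 < k → k ≤ m → circulant m r (a + k) a ≡ (1≤ m ∸ k ≤ᵇ r)
  circulant-backward a k 0<k k≤m = cong (1≤_≤ᵇ r) (begin
    (a + m ∸ (a + k)) % m ≡⟨ cong (_% m) ([m+n]∸[m+o]≡n∸o a m k) ⟩
    (m ∸ k) % m           ≡⟨ m<n⇒m%n≡m (∸-monoʳ-< 0<k k≤m) ⟩
    m ∸ k                 ∎)

  circulant-antisym : r + r < m → ∀ {a b} → a < m → b < m →
                      circulant m r a b ≡ true → circulant m r b a ≡ false
  circulant-antisym 2r<m {a} {b} a<m b<m ab = ¬-not λ ba → [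
    (λ a≤b → no-2-cycle a≤b b<m ab ba) ,
    (λ b≤a → no-2-cycle b≤a a<m ba ab) ]′ (≤-total a b)
    where
    -- The arcs a → a + k and a + k → a would have lengths k and m ∸ k, summing to m > r + r.
    no-2-cycle : ∀ {a b} → a ≤ b → b < m → circulant m r a b ≡ true → circulant m r b a ≡ true → ⊥
    no-2-cycle {a} a≤b b<m ab ba with m≤n⇒∃[o]m+o≡n a≤b
    ... | zero  , refl = contradiction (trans (sym (circulant-forward a 0 (≤-<-trans z≤n b<m))) ab) λ ()
    ... | suc k , refl = <⇒≱ 2r<m (subst (_≤ r + r) (m+[n∸m]≡n (<⇒≤ k<m)) (+-mono-≤
        (1≤≤ᵇ⇒≤ (suc k) r (trans (sym (circulant-forward a (suc k) k<m)) ab))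
        (1≤≤ᵇ⇒≤ (m ∸ suc k) r (trans (sym (circulant-backward a (suc k) z<s (<⇒≤ k<m))) ba))))
      where
      k<m : suc k < m
      k<m = ≤-<-trans (m≤n+m (suc k) a) b<m

IsCopy : ∀ {h n} → Digraph h → Digraph n → (Fin h → Fin n) → Set
IsCopy H G c = (∀ i j → H i j ≡ true → G (c i) (c j) ≡ true) × (∀ i j → c i ≡ c j → i ≡ j)

module _ {h n m} (φ : Fin m → Fin h → Fin n)
         (disjoint : ∀ k k′ i i′ → φ k i ≡ φ k′ i′ → (k ≡ k′) × (i ≡ i′))
         (cover : ∀ v → ∃ λ k → ∃ λ i → φ k i ≡ v) where

  private
    flatten : Permutation (m * h) n
    flatten = permutation (uncurry φ ∘ remQuot h) unflatten flatten∘unflatten unflatten∘flatten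
      where
      unflatten : Fin n → Fin (m * h)
      unflatten v = combine (proj₁ (cover v)) (proj₁ (proj₂ (cover v)))
      flatten∘unflatten : ∀ v → uncurry φ (remQuot h (unflatten v)) ≡ v
      flatten∘unflatten v = trans (cong (uncurry φ) (remQuot-combine _ _)) (proj₂ (proj₂ (cover v)))
      unflatten∘flatten : ∀ x → unflatten (uncurry φ (remQuot h x)) ≡ x
      unflatten∘flatten x with disjoint _ _ _ _ (proj₂ (proj₂ (cover (uncurry φ (remQuot h x)))))
      ... | k≡ , i≡ = trans (cong₂ combine k≡ i≡) (combine-remQuot {m} h x)

  ∑-tiling : ∀ w → ∑[ v < n ] w v ≡ ∑[ k < m ] ∑[ i < h ] w (φ k i)
  ∑-tiling w = begin
    ∑[ v < n ] w v                                       ≡⟨ sum-permute w flatten ⟩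
    ∑[ x < m * h ] w (uncurry φ (remQuot h x))           ≡⟨ ∑-combine m h _ ⟩
    ∑[ k < m ] ∑[ i < h ] w (uncurry φ (remQuot h (combine k i)))
        ≡⟨ sum-cong-≗ (λ k → sum-cong-≗ (λ i → cong (w ∘ uncurry φ) (remQuot-combine k i))) ⟩
    ∑[ k < m ] ∑[ i < h ] w (φ k i)                      ∎

tiling-∣ : ∀ {h n d} {H : Digraph h} {G : Digraph n} (w : Fin n → ℕ) → PerfectTiling H G →
           (∀ c → IsCopy H G c → d ∣ ∑[ i < h ] w (c i)) → d ∣ ∑[ v < n ] w v
tiling-∣ {d = d} w (m , φ , hom , disjoint , cover) copy-∣ =
  subst (d ∣_) (sym (∑-tiling φ disjoint cover w))
        (∑-∣ _ (λ k → copy-∣ (φ k) (hom k , λ i j eq → proj₂ (disjoint k k i j eq))))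

next : Fin 3 → Fin 3
next 0F = 1F
next 1F = 2F
next 2F = 0F

module _ (s : ℕ) .{{_ : NonZero s}} where

  part-combine : ∀ (P : Fin 3) (j : Fin s) → part s (combine P j) ≡ toℕ P
  part-combine P j = begin
    toℕ (combine P j) / s          ≡⟨ cong (_/ s) (toℕ-combine P j) ⟩
    (s * toℕ P + toℕ j) / s        ≡⟨ cong (λ x → (x + toℕ j) / s) (*-comm s (toℕ P)) ⟩
    (toℕ P * s + toℕ j) / s        ≡⟨ +-distrib-/-∣ˡ (toℕ j) (divides (toℕ P) refl) ⟩
    toℕ P * s / s + toℕ j / s      ≡⟨ cong₂ _+_ (m*n/n≡m (toℕ P) s) (m<n⇒m/n≡0 (toℕ<n j)) ⟩
    toℕ P + 0                      ≡⟨ +-identityʳ (toℕ P) ⟩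
    toℕ P                          ∎

  D-next : ∀ P (j j′ : Fin s) → D s (combine P j) (combine (next P) j′) ≡ true
  D-next P j j′ = trans (cong₂ arcBetween (part-combine P j) (part-combine (next P) j′)) (consecutive P)
    where
    arcBetween : ℕ → ℕ → Bool
    arcBetween p p′ =
      if p ≡ᵇ p′ then toℕ (combine P j) <ᵇ toℕ (combine (next P) j′) else (p′ ≡ᵇ (p + 1) % 3)
    consecutive : ∀ Q → arcBetween (toℕ Q) (toℕ (next Q)) ≡ true
    consecutive 0F = refl
    consecutive 1F = refl
    consecutive 2F = refl

  D-cyclic : ∀ P (j₀ j₁ j₂ : Fin s) →
             D s (combine P j₀) (combine (next P) j₁) ≡ true ×
             D s (combine (next P) j₁) (combine (next (next P)) j₂) ≡ true ×
             D s (combine (next (next P)) j₂) (combine P j₀) ≡ true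
  D-cyclic 0F j₀ j₁ j₂ = D-next 0F j₀ j₁ , D-next 1F j₁ j₂ , D-next 2F j₂ j₀
  D-cyclic 1F j₀ j₁ j₂ = D-next 1F j₀ j₁ , D-next 2F j₁ j₂ , D-next 0F j₂ j₀
  D-cyclic 2F j₀ j₁ j₂ = D-next 2F j₀ j₁ , D-next 0F j₁ j₂ , D-next 1F j₂ j₀

data Layer : Set where
  L₀ L₁ L₂ : Layer

_≟L₀ : (l : Layer) → Dec (l ≡ L₀)
L₀ ≟L₀ = yes refl
L₁ ≟L₀ = no λ ()
L₂ ≟L₀ = no λ ()

weight₀ : Layer → ℕ
weight₀ L₀ = 1
weight₀ _  = 0

weight₀-≢L₀ : ∀ {l} → l ≢ L₀ → weight₀ l ≡ 0
weight₀-≢L₀ {L₀} l≢L₀ = contradiction refl l≢L₀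
weight₀-≢L₀ {L₁} _    = refl
weight₀-≢L₀ {L₂} _    = refl

module Construction (q : ℕ) where

  S₀ S₁ S₂ N δ⁰ : ℕ
  S₀ = suc (q + q)
  S₁ = suc S₀
  S₂ = suc S₁
  N  = S₀ + (S₁ + S₂)
  δ⁰ = q + S₁

  S₁≡2*[1+q] : S₁ ≡ 2 * suc q
  S₁≡2*[1+q] = lemma q
    where
    lemma : ∀ q → suc (suc (q + q)) ≡ 2 * suc q
    lemma = solve-∀

  N≡3*S₁ : N ≡ 3 * S₁
  N≡3*S₁ = lemma q
    where
    lemma : ∀ q → suc (q + q) + (suc (suc (q + q)) + suc (suc (suc (q + q)))) ≡ 3 * suc (suc (q + q))
    lemma = solve-∀

  q≤N : q ≤ N
  q≤N = ≤-trans (m≤m+n q q) (≤-trans (n≤1+n (q + q)) (m≤m+n S₀ (S₁ + S₂)))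

  Vertex : Set
  Vertex = Fin S₀ ⊎ Fin S₁ ⊎ Fin S₂

  pattern v₀ a = inj₁ a
  pattern v₁ b = inj₂ (inj₁ b)
  pattern v₂ c = inj₂ (inj₂ c)

  arc : Vertex → Vertex → Bool
  arc (v₀ a) (v₀ a′) = circulant S₀ q (toℕ a) (toℕ a′)
  arc (v₀ _) (v₁ _)  = true
  arc (v₀ _) (v₂ _)  = false
  arc (v₁ _) (v₀ _)  = false
  arc (v₁ b) (v₁ b′) = circulant S₁ q (toℕ b) (toℕ b′)
  arc (v₁ b) (v₂ c)  = not (toℕ c ≡ᵇ toℕ b)
  arc (v₂ _) (v₀ _)  = true
  arc (v₂ c) (v₁ b)  = toℕ c ≡ᵇ toℕ b
  arc (v₂ c) (v₂ c′) = circulant S₂ (suc q) (toℕ c) (toℕ c′)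

  locate : Fin N → Vertex
  locate v = map₂ (splitAt S₁) (splitAt S₀ v)

  locate-injective : ∀ {u v} → locate u ≡ locate v → u ≡ v
  locate-injective {u} {v} eq =
    trans (sym (unlocate-locate u)) (trans (cong unlocate eq) (unlocate-locate v))
    where
    unlocate : Vertex → Fin N
    unlocate = join S₀ (S₁ + S₂) ∘ map₂ (join S₁ S₂)
    unlocate-locate : ∀ v → unlocate (locate v) ≡ v
    unlocate-locate v with splitAt S₀ v in split
    ... | inj₁ a = trans (cong (join S₀ (S₁ + S₂)) (sym split)) (join-splitAt S₀ (S₁ + S₂) v)
    ... | inj₂ w = trans (cong (λ w′ → join S₀ (S₁ + S₂) (inj₂ w′)) (join-splitAt S₁ S₂ w))
                         (trans (cong (join S₀ (S₁ + S₂)) (sym split)) (join-splitAt S₀ (S₁ + S₂) v))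

  G : Digraph N
  G u v = arc (locate u) (locate v)

  ∑V : (Vertex → ℕ) → ℕ
  ∑V f = ∑[ a < S₀ ] f (v₀ a) + (∑[ b < S₁ ] f (v₁ b) + ∑[ c < S₂ ] f (v₂ c))

  ∑-locate : ∀ f → ∑[ v < N ] f (locate v) ≡ ∑V f
  ∑-locate f = trans (∑-++ S₀ (f ∘ locate)) (cong₂ _+_
    (sum-cong-≗ (λ a → cong (f ∘ map₂ (splitAt S₁)) (splitAt-↑ˡ S₀ a (S₁ + S₂))))
    (trans (sum-cong-≗ (λ w → cong (f ∘ map₂ (splitAt S₁)) (splitAt-↑ʳ S₀ (S₁ + S₂) w)))
    (trans (∑-++ S₁ (λ w → f (inj₂ (splitAt S₁ w)))) (cong₂ _+_
      (sum-cong-≗ (λ b → cong (f ∘ inj₂) (splitAt-↑ˡ S₁ b S₂)))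
      (sum-cong-≗ (λ c → cong (f ∘ inj₂) (splitAt-↑ʳ S₁ S₂ c)))))))

  outdegree indegree : Vertex → ℕ
  outdegree x = ∑V (λ y → indicator (arc x y))
  indegree  x = ∑V (λ y → indicator (arc y x))

  private
    q<S₀ : q < S₀
    q<S₀ = s≤s (m≤m+n q q)
    q<S₁ : q < S₁
    q<S₁ = m<n⇒m<1+n q<S₀
    1+q<S₂ : suc q < S₂
    1+q<S₂ = s≤s q<S₁

    δ⁰≡S₀+[1+q] : δ⁰ ≡ S₀ + suc q
    δ⁰≡S₀+[1+q] = lemma q
      where
      lemma : ∀ q → q + suc (suc (q + q)) ≡ suc (q + q) + suc q
      lemma = solve-∀

  outdegree-v₀ : ∀ a → outdegree (v₀ a) ≡ δ⁰
  outdegree-v₀ a = cong₂ _+_ (circulant-outdegree (toℕ<n a) q<S₀)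
                             (trans (cong₂ _+_ (∑-one S₁) (∑-zero S₂)) (+-identityʳ S₁))

  indegree-v₀ : ∀ a → δ⁰ ≤ indegree (v₀ a)
  indegree-v₀ a = subst (δ⁰ ≤_)
    (sym (cong₂ _+_ (circulant-indegree (toℕ<n a) q<S₀) (cong₂ _+_ (∑-zero S₁) (∑-one S₂))))
    (+-monoʳ-≤ q (n≤1+n S₁))

  outdegree-v₁ : ∀ b → outdegree (v₁ b) ≡ δ⁰
  outdegree-v₁ b = cong₂ _+_ (∑-zero S₀)
    (cong₂ _+_ (circulant-outdegree (toℕ<n b) q<S₁) (∑<-≢ᵇ (m<n⇒m<1+n (toℕ<n b))))

  indegree-v₁ : ∀ b → indegree (v₁ b) ≡ δ⁰
  indegree-v₁ b = trans (cong₂ _+_ (∑-one S₀)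
    (trans (cong₂ _+_ (circulant-indegree (toℕ<n b) q<S₁) (∑<-≡ᵇ (m<n⇒m<1+n (toℕ<n b)))) (+-comm q 1)))
    (sym δ⁰≡S₀+[1+q])

  outdegree-v₂ : ∀ c → δ⁰ ≤ outdegree (v₂ c)
  outdegree-v₂ c = subst₂ _≤_ (sym δ⁰≡S₀+[1+q])
    (sym (cong₂ (λ x y → x + (matched + y)) (∑-one S₀) (circulant-outdegree (toℕ<n c) 1+q<S₂)))
    (+-monoʳ-≤ S₀ (m≤n+m (suc q) matched))
    where
    matched : ℕ
    matched = ∑< S₁ (λ b → indicator (toℕ c ≡ᵇ b))

  indegree-v₂ : ∀ c → δ⁰ ≤ indegree (v₂ c)
  indegree-v₂ c = subst₂ _≤_ (sym δ⁰≡S₀+[1+q])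
    (sym (cong₂ (λ x y → x + (unmatched + y)) (∑-zero S₀) (circulant-indegree (toℕ<n c) 1+q<S₂)))
    (+-monoˡ-≤ (suc q) (∑<-≢ᵇ-≥ (toℕ c) S₀))
    where
    unmatched : ℕ
    unmatched = ∑< S₁ (λ b → indicator (not (toℕ c ≡ᵇ b)))

  semidegree-bounds : ∀ x → δ⁰ ≤ outdegree x × δ⁰ ≤ indegree x
  semidegree-bounds (v₀ a) = ≤-reflexive (sym (outdegree-v₀ a)) , indegree-v₀ a
  semidegree-bounds (v₁ b) = ≤-reflexive (sym (outdegree-v₁ b)) , ≤-reflexive (sym (indegree-v₁ b))
  semidegree-bounds (v₂ c) = outdegree-v₂ c , indegree-v₂ c

  arc-irrefl : ∀ x → arc x x ≡ false
  arc-irrefl (v₀ a) = circulant-irrefl (toℕ a)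
  arc-irrefl (v₁ b) = circulant-irrefl (toℕ b)
  arc-irrefl (v₂ c) = circulant-irrefl (toℕ c)

  arc-antisym : ∀ x y → arc x y ≡ true → arc y x ≡ false
  arc-antisym (v₀ a) (v₀ a′) = circulant-antisym (n<1+n (q + q)) (toℕ<n a) (toℕ<n a′)
  arc-antisym (v₁ b) (v₁ b′) = circulant-antisym (m<n⇒m<1+n (n<1+n (q + q))) (toℕ<n b) (toℕ<n b′)
  arc-antisym (v₂ c) (v₂ c′) =
    circulant-antisym (s≤s (s≤s (≤-reflexive (+-suc q q)))) (toℕ<n c) (toℕ<n c′)
  arc-antisym (v₀ _) (v₁ _) _  = refl
  arc-antisym (v₂ _) (v₀ _) _  = refl
  arc-antisym (v₁ b) (v₂ c) bc = trans (sym (not-involutive _)) (cong not bc)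
  arc-antisym (v₂ c) (v₁ b) cb = cong not cb

  [N∸1]/2≡δ⁰ : (N ∸ 1) / 2 ≡ δ⁰
  [N∸1]/2≡δ⁰ = begin
    (N ∸ 1) / 2        ≡⟨ cong (_/ 2) (N∸1≡1+δ⁰*2 q) ⟩
    (1 + δ⁰ * 2) / 2   ≡⟨ +-distrib-/-∣ʳ 1 {d = 2} (divides δ⁰ refl) ⟩
    0 + δ⁰ * 2 / 2     ≡⟨ m*n/n≡m δ⁰ 2 ⟩
    δ⁰                 ∎
    where
    N∸1≡1+δ⁰*2 : ∀ q → q + q + (suc (suc (q + q)) + suc (suc (suc (q + q))))
                     ≡ 1 + (q + suc (suc (q + q))) * 2
    N∸1≡1+δ⁰*2 = solve-∀

  G-semiRegular : IsSemiRegularTournament G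
  G-semiRegular = (arc-irrefl ∘ locate , λ u v → arc-antisym (locate u) (locate v)) ,
                  subst (MinSemiDegree G) (sym [N∸1]/2≡δ⁰)
                    ((λ v → subst₂ _×_ (cong (δ⁰ ≤_) (sym (outdeg-G v))) (cong (δ⁰ ≤_) (sym (indeg-G v)))
                                       (semidegree-bounds (locate v))) ,
                     (zero , inj₁ (trans (outdeg-G zero) (outdegree-v₀ zero))))
    where
    outdeg-G : ∀ v → outdeg G v ≡ outdegree (locate v)
    outdeg-G v = trans (sum-allFin N _) (∑-locate (λ y → indicator (arc (locate v) y)))
    indeg-G : ∀ v → indeg G v ≡ indegree (locate v)
    indeg-G v = trans (sum-allFin N _) (∑-locate (λ y → indicator (arc y (locate v))))

  layer : Vertex → Layer
  layer (v₀ _) = L₀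
  layer (v₁ _) = L₁
  layer (v₂ _) = L₂

  V₀-weight : ∑[ v < N ] weight₀ (layer (locate v)) ≡ S₀
  V₀-weight = trans (∑-locate (weight₀ ∘ layer))
    (trans (cong₂ _+_ (∑-one S₀) (cong₂ _+_ (∑-zero S₁) (∑-zero S₂))) (+-identityʳ S₀))

  Arc : Vertex → Vertex → Set
  Arc x y = arc x y ≡ true

  cyclic-triangle-at-V₀ : ∀ x y z → layer x ≡ L₀ → Arc x y → Arc y z → Arc z x →
                          (layer y ≡ L₀ × layer z ≡ L₀) ⊎ (layer y ≡ L₁ × layer z ≡ L₂)
  cyclic-triangle-at-V₀ (v₀ _) (v₀ _) (v₀ _) _ _ _ _  = inj₁ (refl , refl)
  cyclic-triangle-at-V₀ (v₀ _) (v₁ _) (v₂ _) _ _ _ _  = inj₂ (refl , refl)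
  cyclic-triangle-at-V₀ (v₀ _) (v₀ _) (v₁ _) _ _ _ ()
  cyclic-triangle-at-V₀ (v₀ _) (v₀ _) (v₂ _) _ _ () _
  cyclic-triangle-at-V₀ (v₀ _) (v₁ _) (v₀ _) _ _ () _
  cyclic-triangle-at-V₀ (v₀ _) (v₁ _) (v₁ _) _ _ _ ()
  cyclic-triangle-at-V₀ (v₀ _) (v₂ _) _      _ () _ _
  cyclic-triangle-at-V₀ (v₁ _) _      _      () _ _ _
  cyclic-triangle-at-V₀ (v₂ _) _      _      () _ _ _

  V₂-out-unique : ∀ x y y′ → layer x ≡ L₂ → layer y ≡ L₁ → layer y′ ≡ L₁ →
                  Arc x y → Arc x y′ → y ≡ y′
  V₂-out-unique (v₂ c) (v₁ b) (v₁ b′) _ _ _ cb cb′ =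
    cong v₁ (toℕ-injective {S₁} (trans (sym (≡ᵇ-true⇒≡ (toℕ c) (toℕ b) cb))
                                       (≡ᵇ-true⇒≡ (toℕ c) (toℕ b′) cb′)))
  V₂-out-unique (v₀ _) _      _      () _  _  _ _
  V₂-out-unique (v₁ _) _      _      () _  _  _ _
  V₂-out-unique (v₂ _) (v₀ _) _      _  () _  _ _
  V₂-out-unique (v₂ _) (v₂ _) _      _  () _  _ _
  V₂-out-unique (v₂ _) (v₁ _) (v₀ _) _  _  () _ _
  V₂-out-unique (v₂ _) (v₁ _) (v₂ _) _  _  () _ _

  V₁-in-unique : ∀ x z z′ → layer x ≡ L₁ → layer z ≡ L₂ → layer z′ ≡ L₂ →
                 Arc z x → Arc z′ x → z ≡ z′
  V₁-in-unique (v₁ b) (v₂ c) (v₂ c′) _ _ _ cb c′b =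
    cong v₂ (toℕ-injective {S₂} (trans (≡ᵇ-true⇒≡ (toℕ c) (toℕ b) cb)
                                       (sym (≡ᵇ-true⇒≡ (toℕ c′) (toℕ b) c′b))))
  V₁-in-unique (v₀ _) _      _      () _  _  _ _
  V₁-in-unique (v₂ _) _      _      () _  _  _ _
  V₁-in-unique (v₁ _) (v₀ _) _      _  () _  _ _
  V₁-in-unique (v₁ _) (v₁ _) _      _  () _  _ _
  V₁-in-unique (v₁ _) (v₂ _) (v₀ _) _  _  () _ _
  V₁-in-unique (v₁ _) (v₂ _) (v₁ _) _  _  () _ _

  module _ {s′ : ℕ} (c : Fin (3 * suc (suc s′)) → Fin N) (copy : IsCopy (D (suc (suc s′))) G c) where

    private
      s : ℕ
      s = suc (suc s′)

    image : Fin 3 → Fin s → Vertex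
    image P j = locate (c (combine P j))

    image-cyclic : ∀ P j₀ j₁ j₂ → Arc (image P j₀) (image (next P) j₁) ×
                                  Arc (image (next P) j₁) (image (next (next P)) j₂) ×
                                  Arc (image (next (next P)) j₂) (image P j₀)
    image-cyclic P j₀ j₁ j₂ with D-cyclic s P j₀ j₁ j₂
    ... | d₀₁ , d₁₂ , d₂₀ = proj₁ copy _ _ d₀₁ , proj₁ copy _ _ d₁₂ , proj₁ copy _ _ d₂₀

    image-injective : ∀ P {j j′} → image P j ≡ image P j′ → j ≡ j′
    image-injective P {j} {j′} eq =
      proj₂ (combine-injective P j P j′ (proj₂ copy _ _ (locate-injective eq)))

    image-triangle-at-V₀ : ∀ X j₀ → layer (image X j₀) ≡ L₀ → ∀ j₁ j₂ →
      (layer (image (next X) j₁) ≡ L₀ × layer (image (next (next X)) j₂) ≡ L₀) ⊎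
      (layer (image (next X) j₁) ≡ L₁ × layer (image (next (next X)) j₂) ≡ L₂)
    image-triangle-at-V₀ X j₀ x₀∈V₀ j₁ j₂ with image-cyclic X j₀ j₁ j₂
    ... | a₀₁ , a₁₂ , a₂₀ = cyclic-triangle-at-V₀ _ _ _ x₀∈V₀ a₀₁ a₁₂ a₂₀

    next-part-in-V₁ : ∀ X j₀ {j₂} → layer (image X j₀) ≡ L₀ →
      layer (image (next (next X)) j₂) ≡ L₂ → ∀ j₁ → layer (image (next X) j₁) ≡ L₁
    next-part-in-V₁ X j₀ {j₂} x₀∈V₀ z∈V₂ j₁ with image-triangle-at-V₀ X j₀ x₀∈V₀ j₁ j₂
    ... | inj₁ (_ , z∈V₀) = contradiction (trans (sym z∈V₀) z∈V₂) λ ()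
    ... | inj₂ (y∈V₁ , _) = y∈V₁

    next²-part-in-V₂ : ∀ X j₀ {j₁} → layer (image X j₀) ≡ L₀ →
      layer (image (next X) j₁) ≡ L₁ → ∀ j₂ → layer (image (next (next X)) j₂) ≡ L₂
    next²-part-in-V₂ X j₀ {j₁} x₀∈V₀ y∈V₁ j₂ with image-triangle-at-V₀ X j₀ x₀∈V₀ j₁ j₂
    ... | inj₁ (y∈V₀ , _) = contradiction (trans (sym y∈V₀) y∈V₁) λ ()
    ... | inj₂ (_ , z∈V₂) = z∈V₂

    -- The triangle through (X, j) is read from its vertex in part next X, which lies in V₀.
    in-V₀-if-inside : ∀ X j → layer (image (next X) 0F) ≡ L₀ →
      layer (image (next (next X)) 0F) ≡ L₀ → layer (image X j) ≡ L₀
    in-V₀-if-inside X j y∈V₀ z∈V₀ with image-cyclic X j 0F 0F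
    ... | a₀₁ , a₁₂ , a₂₀ with cyclic-triangle-at-V₀ _ _ _ y∈V₀ a₁₂ a₂₀ a₀₁
    ...   | inj₁ (_ , x∈V₀) = x∈V₀
    ...   | inj₂ (z∈V₁ , _) = contradiction (trans (sym z∈V₀) z∈V₁) λ ()

    in-V₀-if-across : ∀ X j →
      layer (image (next X) 0F) ≡ L₁ → layer (image (next X) 1F) ≡ L₁ →
      layer (image (next (next X)) 0F) ≡ L₂ → layer (image (next (next X)) 1F) ≡ L₂ →
      layer (image X j) ≡ L₀
    in-V₀-if-across X j y∈V₁ y′∈V₁ z∈V₂ z′∈V₂ with layer (image X j) in x-layer
    ... | L₀ = refl
    ... | L₁ = contradiction (image-injective (next (next X))
                 (V₁-in-unique (image X j) (image (next (next X)) 0F) (image (next (next X)) 1F)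
                   x-layer z∈V₂ z′∈V₂
                   (proj₂ (proj₂ (image-cyclic X j 0F 0F))) (proj₂ (proj₂ (image-cyclic X j 0F 1F))))) λ ()
    ... | L₂ = contradiction (image-injective (next X)
                 (V₂-out-unique (image X j) (image (next X) 0F) (image (next X) 1F)
                   x-layer y∈V₁ y′∈V₁
                   (proj₁ (image-cyclic X j 0F 0F)) (proj₁ (image-cyclic X j 1F 0F)))) λ ()

    part-in-V₀ : ∀ X j₀ → layer (image X j₀) ≡ L₀ → ∀ j → layer (image X j) ≡ L₀
    part-in-V₀ X j₀ x₀∈V₀ j with image-triangle-at-V₀ X j₀ x₀∈V₀ 0F 0F
    ... | inj₁ (y∈V₀ , z∈V₀) = in-V₀-if-inside X j y∈V₀ z∈V₀
    ... | inj₂ (y∈V₁ , z∈V₂) =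
      in-V₀-if-across X j y∈V₁ (next-part-in-V₁ X j₀ x₀∈V₀ z∈V₂ 1F)
                          z∈V₂ (next²-part-in-V₂ X j₀ x₀∈V₀ y∈V₁ 1F)

    part-weight-∣ : ∀ P → s ∣ ∑[ j < s ] weight₀ (layer (image P j))
    part-weight-∣ P with any? (λ j → layer (image P j) ≟L₀)
    ... | yes (j₀ , x₀∈V₀) = subst (s ∣_)
            (sym (trans (sum-cong-≗ (cong weight₀ ∘ part-in-V₀ P j₀ x₀∈V₀)) (∑-one s))) ∣-refl
    ... | no none = subst (s ∣_)
            (sym (trans (sum-cong-≗ (λ j → weight₀-≢L₀ (none ∘ (j ,_)))) (∑-zero s))) (s ∣0)

    copy-weight-∣ : s ∣ ∑[ i < 3 * s ] weight₀ (layer (locate (c i)))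
    copy-weight-∣ = subst (s ∣_) (sym (∑-combine 3 s (weight₀ ∘ layer ∘ locate ∘ c)))
                          (∑-∣ (λ P → ∑[ j < s ] weight₀ (layer (image P j))) part-weight-∣)

theorem1p10 : (s : ℕ) .{{_ : NonZero s}} → 2 ≤ s → ¬ Tileable (D s)
theorem1p10 (suc zero) (s≤s ())
theorem1p10 (suc (suc s′)) _ (n₀ , tileable) = contradiction (∣1⇒≡1 s∣1) λ ()
  where
  s q : ℕ
  s = suc (suc s′)
  -- q + 1 = s (n₀ + 1), so s divides |V₁| = |V₀| + 1.
  q = suc s′ + s * n₀
  open Construction q

  s∣1+q : s ∣ suc q
  s∣1+q = subst (s ∣_) (*-suc s n₀) (m∣m*n (suc n₀))

  s∣S₁ : s ∣ S₁
  s∣S₁ = subst (s ∣_) (sym S₁≡2*[1+q]) (∣-trans s∣1+q (n∣m*n 2))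

  tiling : PerfectTiling (D s) G
  tiling = tileable N (≤-trans (≤-trans (m≤n*m n₀ s) (m≤n+m (s * n₀) (suc s′))) q≤N)
                      (subst (3 * s ∣_) (sym N≡3*S₁) (*-monoʳ-∣ 3 s∣S₁)) G G-semiRegular

  s∣S₀ : s ∣ S₀
  s∣S₀ = subst (s ∣_) V₀-weight
           (tiling-∣ {G = G} (weight₀ ∘ layer ∘ locate) tiling (copy-weight-∣ {s′}))

  s∣1 : s ∣ 1
  s∣1 = ∣m+n∣m⇒∣n (subst (s ∣_) (+-comm 1 S₀) s∣S₁) s∣S₀
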